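{- For every integer $\Delta\ge1$ there is a constant $c_\Delta$ (depending only on $\Delta$) such that the following holds for all integers $n\ge 2$ and $d\ge 1$. Let $U$ and $U'$ be two graphs with maximum degree $d$. If $U$ contains every $n$-vertex graph of maximum degree at most $\Delta$ as an induced subgraph and $U'$ contains every $n$-vertex graph of maximum degree at most $\Delta$ as a subgraph, then \[ |V(U)|\ge \exp\Big(n\big((\Delta/2-1)\log n-c_\Delta-\log(4d)\big)\Big) \] and \[ |V(U')|\ge \exp\Big(n\big((\Delta/2-1)\log n-c_\Delta-\log(4d)-2\Delta\log\tfrac{de}{\Delta}\big)\Big). \] In particular, if $d=n^{o(1)}$ as $n\to\infty$, then $|V(U)|\ge n^{(\Delta/2-1-o(1))n}$ and $|V(U')|\ge n^{(\Delta/2-1-o(1))n}$.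
   Context: $\log$ denotes the natural logarithm. "$U$ contains $H$ as a (induced) subgraph" means $U$ has a (induced) subgraph isomorphic to $H$. -}

module Defs where

open import Data.Nat using (ℕ; zero; suc; _+_; _*_; _^_; _≤_)
open import Data.Bool using (Bool; true; false; if_then_else_)
open import Data.Fin using (Fin)
open import Data.Product using (Σ; ∃; _×_)
open import Data.Vec.Functional using (foldr)
open import Relation.Binary.PropositionalEquality using (_≡_)
open import Function.Definitions using (Injective)

record Graph (N : ℕ) : Set where
  field
    adj   : Fin N → Fin N → Bool
    sym   : ∀ u v → adj u v ≡ adj v u
    irrefl : ∀ v → adj v v ≡ false
open Graph public

∣V∣ : ∀ {N} → Graph N → ℕ
∣V∣ {N} _ = N

degree : ∀ {N} → Graph N → Fin N → ℕ
degree {N} G v = foldr (λ w acc → (if adj G v w then 1 else 0) + acc) 0 (λ w → w)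

MaxDegreeAtMost : ∀ {N} → Graph N → ℕ → Set
MaxDegreeAtMost G Δ = ∀ v → degree G v ≤ Δ

HasMaxDegree : ∀ {N} → Graph N → ℕ → Set
HasMaxDegree {N} G d = MaxDegreeAtMost G d × Σ (Fin N) (λ v → degree G v ≡ d)

InducedSub : ∀ {n N} → Graph n → Graph N → Set
InducedSub {n} {N} H U =
  Σ (Fin n → Fin N) λ f → Injective _≡_ _≡_ f × (∀ i j → adj U (f i) (f j) ≡ adj H i j)

Sub : ∀ {n N} → Graph n → Graph N → Set
Sub {n} {N} H U =
  Σ (Fin n → Fin N) λ f → Injective _≡_ _≡_ f × (∀ i j → adj H i j ≡ true → adj U (f i) (f j) ≡ true)

InducedUniversal : ℕ → ℕ → ∀ {N} → Graph N → Set
InducedUniversal Δ n U = (H : Graph n) → MaxDegreeAtMost H Δ → InducedSub H U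

Universal : ℕ → ℕ → ∀ {N} → Graph N → Set
Universal Δ n U = (H : Graph n) → MaxDegreeAtMost H Δ → Sub H U

-- Let Δ = 2 + k and m = ⌊n/2⌋. For every k-tuple σ of permutations of Fin m, the graph on Fin n
-- formed by the path 0 – 1 – ⋯ – (n-1) and the k matchings a – (m + σⱼ a) has maximum degree at
-- most Δ, and there are (m!)ᵏ such tuples. An embedding f of such a graph into U is in particular a
-- walk in U, so it is determined by f 0 and, for each step, the index of f (i+1) among the at most d
-- neighbours of f i. The tuple σ is then recovered from one further index per matching edge: the
-- index of f (m + σⱼ a) among the U-neighbours of f a for subgraph embeddings, and, because an
-- induced embedding also determines the graph being embedded, the index of m + σⱼ a among its at
-- most Δ neighbours in that graph for induced ones. Hence (m!)ᵏ ≤ N · dⁿ⁻¹ · bᵐᵏ with b = Δ resp.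
-- b = d. Squaring and using (m+1)ᵐ ≤ 4ᵐ m! (proved by halving m) gives both bounds with
-- K = (64Δ)^(2Δ); for Δ = 1 they hold trivially.

module Submission where

open import Defs
open import Data.Bool.Base using (Bool; true; false; if_then_else_; _∨_)
open import Data.Bool.Properties using (∨-comm; ∨-zeroʳ; ¬-not)
open import Data.Empty using (⊥-elim)
open import Data.Fin.Base
  using ( Fin; zero; suc; fromℕ<; inject₁; inject≤; _↑ˡ_; _↑ʳ_; splitAt; punchIn
        ; quotient; remainder; combine; funToFin; finToFun )
open import Data.Fin.Induction using (<-weakInduction)
open import Data.Fin.Properties
  using ( _≟_; any?; 0≢1+n; nonZeroIndex; suc-injective; inject₁-injective; inject≤-injective
        ; ↑ˡ-injective; ↑ʳ-injective; splitAt-↑ˡ; splitAt-↑ʳ; fromℕ<-injective; injective⇒≤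
        ; punchInᵢ≢i; punchIn-injective; combine-injective; combine-remQuot
        ; funToFin-finToFin; finToFun-funToFin )
open import Data.Nat.Base
  using (ℕ; zero; suc; _+_; _*_; _^_; _≤_; _<_; _≥_; z≤n; s≤s; _!; ⌊_/2⌋; ⌈_/2⌉; NonZero)
open import Data.Nat.Induction using (<-rec)
open import Data.Nat.Properties
  using ( module ≤-Reasoning; ≤-refl; ≤-reflexive; ≤-trans; n≤1+n; m≤m+n; m≤n*m
        ; +-suc; +-identityʳ; +-cancelˡ-≡; +-mono-≤; +-monoˡ-≤; +-monoʳ-≤; +-monoʳ-<
        ; *-comm; *-identityʳ; *-distribʳ-+; *-mono-≤; *-monoˡ-≤; *-monoʳ-≤; m*n≢0
        ; ^-zeroˡ; ^-distribˡ-+-*; ^-*-assoc; ^-monoˡ-≤; ^-monoʳ-≤; m^n>0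
        ; ⌊n/2⌋+⌈n/2⌉≡n; ⌊n/2⌋≤⌈n/2⌉; ⌊n/2⌋<n )
open import Data.Nat.Tactic.RingSolver using (solve-∀)
open import Data.Product using (Σ; ∃; _×_; _,_; proj₁; proj₂)
open import Data.Sum using (_⊎_; inj₁; inj₂)
open import Data.Vec.Functional using (foldr)
open import Function.Base using (_∘_)
open import Function.Definitions using (Injective)
open import Relation.Binary.PropositionalEquality as ≡
  using (_≡_; _≢_; _≗_; refl; trans; cong; cong₂; subst)
open import Relation.Nullary.Decidable using (Dec; yes; does; dec-true; dec-false; _×-dec_)

count : ∀ {N} → (Fin N → Bool) → ℕ
count {zero}  P = 0
count {suc N} P = (if P zero then 1 else 0) + count (P ∘ suc)

rank : ∀ {N} → (Fin N → Bool) → Fin N → ℕ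
rank P zero    = 0
rank P (suc y) = (if P zero then 1 else 0) + rank (P ∘ suc) y

count-false : ∀ {N} (P : Fin N → Bool) → (∀ x → P x ≡ false) → count P ≡ 0
count-false {zero}  P _   = refl
count-false {suc N} P P≡f rewrite P≡f zero = count-false (P ∘ suc) (P≡f ∘ suc)

count-∨ : ∀ {N} (P Q : Fin N → Bool) → count (λ x → P x ∨ Q x) ≤ count P + count Q
count-∨ {zero}  P Q = z≤n
count-∨ {suc N} P Q with P zero | Q zero
... | false | false = count-∨ (P ∘ suc) (Q ∘ suc)
... | false | true  = ≤-trans (s≤s (count-∨ (P ∘ suc) (Q ∘ suc))) (≤-reflexive (≡.sym (+-suc _ _)))
... | true  | false = s≤s (count-∨ (P ∘ suc) (Q ∘ suc))
... | true  | true  = s≤s (≤-trans (count-∨ (P ∘ suc) (Q ∘ suc)) (+-monoʳ-≤ _ (n≤1+n _)))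

count≤1 : ∀ {N} (P : Fin N → Bool) → (∀ {x y} → P x ≡ true → P y ≡ true → x ≡ y) → count P ≤ 1
count≤1 {zero}  P unique = z≤n
count≤1 {suc N} P unique with P zero in P0
... | true  = ≤-reflexive (cong suc (count-false (P ∘ suc) (λ _ → ¬-not (0≢1+n ∘ unique P0))))
... | false = count≤1 (P ∘ suc) (λ Px Py → suc-injective (unique Px Py))

rank<count : ∀ {N} (P : Fin N → Bool) {y} → P y ≡ true → rank P y < count P
rank<count P {zero}  Py rewrite Py = s≤s z≤n
rank<count P {suc y} Py = +-monoʳ-< _ (rank<count (P ∘ suc) Py)

rank-injective : ∀ {N} (P : Fin N → Bool) {y y′} → P y ≡ true → P y′ ≡ true →
                 rank P y ≡ rank P y′ → y ≡ y′
rank-injective P {zero}  {zero}   _  _   _  = refl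
rank-injective P {zero}  {suc y′} Py _   eq rewrite Py with eq
... | ()
rank-injective P {suc y} {zero}   _  Py′ eq rewrite Py′ with eq
... | ()
rank-injective P {suc y} {suc y′} Py Py′ eq =
  cong suc (rank-injective (P ∘ suc) Py Py′ (+-cancelˡ-≡ _ _ _ eq))

rank-cong : ∀ {N} {P Q : Fin N → Bool} → P ≗ Q → rank P ≗ rank Q
rank-cong P≗Q zero    = refl
rank-cong P≗Q (suc y) =
  cong₂ _+_ (cong (λ b → if b then 1 else 0) (P≗Q zero)) (rank-cong (P≗Q ∘ suc) y)

index : ∀ {N b} (P : Fin N → Bool) {y} → P y ≡ true → count P ≤ b → Fin b
index P Py P≤b = fromℕ< (≤-trans (rank<count P Py) P≤b)

index-injective : ∀ {N b} {P Q : Fin N → Bool} {y y′} (Py : P y ≡ true) (Qy′ : Q y′ ≡ true)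
                  (P≤b : count P ≤ b) (Q≤b : count Q ≤ b) →
                  P ≗ Q → index P Py P≤b ≡ index Q Qy′ Q≤b → y ≡ y′
index-injective {P = P} {Q} {y} Py Qy′ _ _ P≗Q eq =
  rank-injective Q (trans (≡.sym (P≗Q y)) Py) Qy′
    (trans (≡.sym (rank-cong P≗Q y)) (fromℕ<-injective _ _ _ _ eq))

degree≡count : ∀ {N} (G : Graph N) v → degree G v ≡ count (adj G v)
degree≡count G v = foldr≡count (adj G v) (λ w → w)
  where
  foldr≡count : ∀ {M N} (P : Fin M → Bool) (h : Fin N → Fin M) →
                foldr (λ w acc → (if P w then 1 else 0) + acc) 0 h ≡ count (P ∘ h)
  foldr≡count {N = zero}  P h = refl
  foldr≡count {N = suc N} P h =
    cong ((if P (h zero) then 1 else 0) +_) (foldr≡count P (h ∘ suc))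

count⇒maxDegree : ∀ {N} (G : Graph N) {Δ} → (∀ v → count (adj G v) ≤ Δ) → MaxDegreeAtMost G Δ
count⇒maxDegree G bound v = subst (_≤ _) (≡.sym (degree≡count G v)) (bound v)

maxDegree⇒count : ∀ {N} (G : Graph N) {Δ} → MaxDegreeAtMost G Δ → ∀ v → count (adj G v) ≤ Δ
maxDegree⇒count G G≤Δ v = subst (_≤ _) (degree≡count G v) (G≤Δ v)

nbrIndex : ∀ {N d} (G : Graph N) → MaxDegreeAtMost G d → ∀ {x y} → adj G x y ≡ true → Fin d
nbrIndex G G≤d {x} e = index (adj G x) e (maxDegree⇒count G G≤d x)

nbrIndex-injective : ∀ {N d} (G G′ : Graph N) (G≤d : MaxDegreeAtMost G d) (G′≤d : MaxDegreeAtMost G′ d)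
                     {x x′ y y′} (e : adj G x y ≡ true) (e′ : adj G′ x′ y′ ≡ true) →
                     adj G x ≗ adj G′ x′ → nbrIndex G G≤d e ≡ nbrIndex G′ G′≤d e′ → y ≡ y′
nbrIndex-injective G G′ G≤d G′≤d {x} {x′} e e′ =
  index-injective e e′ (maxDegree⇒count G G≤d x) (maxDegree⇒count G′ G′≤d x′)

empty : ∀ {N} → Graph N
empty = record { adj = λ _ _ → false ; sym = λ _ _ → refl ; irrefl = λ _ → refl }

_∪_ : ∀ {N} → Graph N → Graph N → Graph N
G ∪ G′ = record
  { adj    = λ x y → adj G x y ∨ adj G′ x y
  ; sym    = λ x y → cong₂ _∨_ (sym G x y) (sym G′ x y)
  ; irrefl = λ x → cong₂ _∨_ (irrefl G x) (irrefl G′ x)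
  }

⋃ : ∀ {k N} → (Fin k → Graph N) → Graph N
⋃ {zero}  Gs = empty
⋃ {suc k} Gs = Gs zero ∪ ⋃ (Gs ∘ suc)

adj-∪ˡ : ∀ {N} (G G′ : Graph N) {x y} → adj G x y ≡ true → adj (G ∪ G′) x y ≡ true
adj-∪ˡ G G′ e rewrite e = refl

adj-∪ʳ : ∀ {N} (G G′ : Graph N) {x y} → adj G′ x y ≡ true → adj (G ∪ G′) x y ≡ true
adj-∪ʳ G G′ {x} {y} e rewrite e = ∨-zeroʳ (adj G x y)

adj-⋃ : ∀ {k N} (Gs : Fin k → Graph N) j {x y} → adj (Gs j) x y ≡ true → adj (⋃ Gs) x y ≡ true
adj-⋃ Gs zero    e = adj-∪ˡ (Gs zero) (⋃ (Gs ∘ suc)) e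
adj-⋃ Gs (suc j) e = adj-∪ʳ (Gs zero) (⋃ (Gs ∘ suc)) (adj-⋃ (Gs ∘ suc) j e)

maxDegree-∪ : ∀ {N a b} (G G′ : Graph N) → MaxDegreeAtMost G a → MaxDegreeAtMost G′ b →
              MaxDegreeAtMost (G ∪ G′) (a + b)
maxDegree-∪ G G′ G≤a G′≤b = count⇒maxDegree (G ∪ G′) λ v →
  ≤-trans (count-∨ (adj G v) (adj G′ v))
          (+-mono-≤ (maxDegree⇒count G G≤a v) (maxDegree⇒count G′ G′≤b v))

maxDegree-⋃ : ∀ {k N b} (Gs : Fin k → Graph N) → (∀ j → MaxDegreeAtMost (Gs j) b) →
              MaxDegreeAtMost (⋃ Gs) (k * b)
maxDegree-⋃ {zero} {N} Gs _ =
  count⇒maxDegree (empty {N}) (λ v → ≤-reflexive (count-false (adj (empty {N}) v) (λ _ → refl)))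
maxDegree-⋃ {suc k} Gs Gs≤b =
  maxDegree-∪ (Gs zero) (⋃ (Gs ∘ suc)) (Gs≤b zero) (maxDegree-⋃ (Gs ∘ suc) (Gs≤b ∘ suc))

module _ {m N} (src tgt : Fin m → Fin N) where

  Joins : Fin N → Fin N → Set
  Joins x y = ∃ λ a → x ≡ src a × y ≡ tgt a

  joins? : ∀ x y → Dec (Joins x y)
  joins? x y = any? λ a → (x ≟ src a) ×-dec (y ≟ tgt a)

  joins : Fin N → Fin N → Bool
  joins x y = does (joins? x y)

  joins⇒ : ∀ {x y} → joins x y ≡ true → Joins x y
  joins⇒ {x} {y} e with joins? x y
  ... | yes p = p

  joins-functional : Injective _≡_ _≡_ src →
                     ∀ {x y y′} → joins x y ≡ true → joins x y′ ≡ true → y ≡ y′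
  joins-functional src-inj e e′ with joins⇒ e | joins⇒ e′
  ... | a , x≡ , y≡ | a′ , x≡′ , y′≡ with src-inj (trans (≡.sym x≡) x≡′)
  ... | refl = trans y≡ (≡.sym y′≡)

  joins-injective : Injective _≡_ _≡_ tgt →
                    ∀ {x x′ y} → joins x y ≡ true → joins x′ y ≡ true → x ≡ x′
  joins-injective tgt-inj e e′ with joins⇒ e | joins⇒ e′
  ... | a , x≡ , y≡ | a′ , x′≡ , y≡′ with tgt-inj (trans (≡.sym y≡) y≡′)
  ... | refl = trans x≡ (≡.sym x′≡)

  fromEdges : (∀ a → src a ≢ tgt a) → Graph N
  fromEdges loopless = record
    { adj    = λ x y → joins x y ∨ joins y x
    ; sym    = λ x y → ∨-comm (joins x y) (joins y x)
    ; irrefl = λ x → cong₂ _∨_ (noLoop x) (noLoop x)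
    }
    where
    noLoop : ∀ x → joins x x ≡ false
    noLoop x = dec-false (joins? x x) λ (a , x≡src , x≡tgt) → loopless a (trans (≡.sym x≡src) x≡tgt)

  module _ (loopless : ∀ a → src a ≢ tgt a) where

    fromEdges-adj : ∀ a → adj (fromEdges loopless) (src a) (tgt a) ≡ true
    fromEdges-adj a rewrite dec-true (joins? (src a) (tgt a)) (a , refl , refl) = refl

    fromEdges-adj⇒ : ∀ {x y} → adj (fromEdges loopless) x y ≡ true →
                     joins x y ≡ true ⊎ joins y x ≡ true
    fromEdges-adj⇒ {x} {y} e with joins x y
    ... | true  = inj₁ refl
    ... | false = inj₂ e

    fromEdges-maxDegree≤2 : Injective _≡_ _≡_ src → Injective _≡_ _≡_ tgt →
                            MaxDegreeAtMost (fromEdges loopless) 2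
    fromEdges-maxDegree≤2 src-inj tgt-inj = count⇒maxDegree (fromEdges loopless) λ x →
      ≤-trans (count-∨ (joins x) (λ y → joins y x))
              (+-mono-≤ (count≤1 _ (joins-functional src-inj)) (count≤1 _ (joins-injective tgt-inj)))

    fromEdges-maxDegree≤1 : Injective _≡_ _≡_ src → Injective _≡_ _≡_ tgt → (∀ a b → src a ≢ tgt b) →
                            MaxDegreeAtMost (fromEdges loopless) 1
    fromEdges-maxDegree≤1 src-inj tgt-inj disjoint = count⇒maxDegree (fromEdges loopless) λ x →
      count≤1 _ λ e e′ → unique (fromEdges-adj⇒ e) (fromEdges-adj⇒ e′)
      where
      crossed : ∀ {x y y′} → joins x y ≡ true → joins y′ x ≡ true → y ≡ y′
      crossed e e′ with joins⇒ e | joins⇒ e′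
      ... | a , x≡ , _ | b , _ , x≡′ = ⊥-elim (disjoint a b (trans (≡.sym x≡) x≡′))

      unique : ∀ {x y y′} → joins x y ≡ true ⊎ joins y x ≡ true → joins x y′ ≡ true ⊎ joins y′ x ≡ true →
               y ≡ y′
      unique (inj₁ e) (inj₁ e′) = joins-functional src-inj e e′
      unique (inj₁ e) (inj₂ e′) = crossed e e′
      unique (inj₂ e) (inj₁ e′) = ≡.sym (crossed e′ e)
      unique (inj₂ e) (inj₂ e′) = joins-injective tgt-inj e e′

inject₁≢suc : ∀ {n} (i : Fin n) → inject₁ i ≢ suc i
inject₁≢suc zero    ()
inject₁≢suc (suc i) eq = inject₁≢suc i (suc-injective eq)

path : ∀ {n} → Graph (suc n)
path = fromEdges inject₁ suc inject₁≢suc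

path-adj : ∀ {n} (i : Fin n) → adj path (inject₁ i) (suc i) ≡ true
path-adj = fromEdges-adj inject₁ suc inject₁≢suc

path-maxDegree : ∀ {n} → MaxDegreeAtMost (path {n}) 2
path-maxDegree = fromEdges-maxDegree≤2 inject₁ suc inject₁≢suc inject₁-injective suc-injective

module PathWithMatchings {n m : ℕ} (m+m≤n : m + m ≤ suc n) where

  left right : Fin m → Fin (suc n)
  left  a = inject≤ (a ↑ˡ m) m+m≤n
  right b = inject≤ (m ↑ʳ b) m+m≤n

  left-injective : Injective _≡_ _≡_ left
  left-injective eq = ↑ˡ-injective m _ _ (inject≤-injective _ _ _ _ eq)

  right-injective : Injective _≡_ _≡_ right
  right-injective eq = ↑ʳ-injective m _ _ (inject≤-injective _ _ _ _ eq)

  left≢right : ∀ a b → left a ≢ right b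
  left≢right a b eq with trans (≡.sym (splitAt-↑ˡ m a m))
                           (trans (cong (splitAt m) (inject≤-injective _ _ _ _ eq)) (splitAt-↑ʳ m m b))
  ... | ()

  matching : (π : Fin m → Fin m) → Graph (suc n)
  matching π = fromEdges left (right ∘ π) (λ a → left≢right a (π a))

  matching-adj : ∀ π a → adj (matching π) (left a) (right (π a)) ≡ true
  matching-adj π = fromEdges-adj left (right ∘ π) (λ a → left≢right a (π a))

  matching-maxDegree : ∀ {π} → Injective _≡_ _≡_ π → MaxDegreeAtMost (matching π) 1
  matching-maxDegree {π} π-inj = fromEdges-maxDegree≤1 left (right ∘ π) (λ a → left≢right a (π a))
    left-injective (π-inj ∘ right-injective) (λ a b → left≢right a (π b))

  pathWithMatchings : ∀ {k} → (Fin k → Fin m → Fin m) → Graph (suc n)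
  pathWithMatchings σ = path ∪ ⋃ (matching ∘ σ)

  pathWithMatchings-path : ∀ {k} (σ : Fin k → Fin m → Fin m) i →
                           adj (pathWithMatchings σ) (inject₁ i) (suc i) ≡ true
  pathWithMatchings-path σ i = adj-∪ˡ path (⋃ (matching ∘ σ)) (path-adj i)

  pathWithMatchings-matching : ∀ {k} (σ : Fin k → Fin m → Fin m) j a →
                               adj (pathWithMatchings σ) (left a) (right (σ j a)) ≡ true
  pathWithMatchings-matching σ j a =
    adj-∪ʳ path (⋃ (matching ∘ σ)) (adj-⋃ (matching ∘ σ) j (matching-adj (σ j) a))

  pathWithMatchings-maxDegree : ∀ {k} (σ : Fin k → Fin m → Fin m) → (∀ j → Injective _≡_ _≡_ (σ j)) →
                                MaxDegreeAtMost (pathWithMatchings σ) (2 + k)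
  pathWithMatchings-maxDegree {k} σ σ-inj =
    subst (MaxDegreeAtMost (pathWithMatchings σ)) (cong (2 +_) (*-identityʳ k))
      (maxDegree-∪ path (⋃ (matching ∘ σ)) path-maxDegree
        (maxDegree-⋃ (matching ∘ σ) (λ j → matching-maxDegree (σ-inj j))))

-- Permutations and codes as elements of Fin

-- Lehmer code: c encodes the image of 0 together with the code of the remaining values.
perm : ∀ {m} → Fin (m !) → Fin m → Fin m
perm {suc m} c zero    = quotient (m !) c
perm {suc m} c (suc x) = punchIn (quotient (m !) c) (perm (remainder {suc m} (m !) c) x)

perm-injective : ∀ {m} (c : Fin (m !)) → Injective _≡_ _≡_ (perm {m} c)
perm-injective {suc m} c {zero}  {zero}  _  = refl
perm-injective {suc m} c {zero}  {suc y} eq = ⊥-elim (punchInᵢ≢i _ _ (≡.sym eq))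
perm-injective {suc m} c {suc x} {zero}  eq = ⊥-elim (punchInᵢ≢i _ _ eq)
perm-injective {suc m} c {suc x} {suc y} eq =
  cong suc (perm-injective (remainder {suc m} (m !) c) (punchIn-injective _ _ _ eq))

perm-≗⇒≡ : ∀ {m} {c c′ : Fin (m !)} → perm {m} c ≗ perm c′ → c ≡ c′
perm-≗⇒≡ {zero}  {zero} {zero} _ = refl
perm-≗⇒≡ {suc m} {c} {c′} eq = begin
  c                                                        ≡⟨ combine-remQuot {suc m} (m !) c ⟨
  combine (quotient (m !) c) (remainder {suc m} (m !) c)
    ≡⟨ cong₂ (combine {suc m} {m !}) (eq zero) remainder≡ ⟩
  combine (quotient (m !) c′) (remainder {suc m} (m !) c′) ≡⟨ combine-remQuot {suc m} (m !) c′ ⟩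
  c′                                                       ∎
  where
  open ≡.≡-Reasoning
  remainder≡ : remainder {suc m} (m !) c ≡ remainder {suc m} (m !) c′
  remainder≡ = perm-≗⇒≡ {m} λ x → punchIn-injective (quotient (m !) c) _ _
    (trans (eq (suc x)) (cong (λ q → punchIn q _) (≡.sym (eq zero))))

funToFin-cong : ∀ {m n} {f g : Fin m → Fin n} → f ≗ g → funToFin f ≡ funToFin g
funToFin-cong {zero}  _   = refl
funToFin-cong {suc m} f≗g = cong₂ combine (f≗g zero) (funToFin-cong (f≗g ∘ suc))

funToFin-injective : ∀ {m n} {f g : Fin m → Fin n} → funToFin f ≡ funToFin g → f ≗ g
funToFin-injective {f = f} {g} eq x = begin
  f x                       ≡⟨ finToFun-funToFin f x ⟨
  finToFun (funToFin f) x   ≡⟨ cong (λ c → finToFun c x) eq ⟩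
  finToFun (funToFin g) x   ≡⟨ finToFun-funToFin g x ⟩
  g x                       ∎
  where open ≡.≡-Reasoning

perms : ∀ {m k} → Fin ((m !) ^ k) → Fin k → Fin m → Fin m
perms {m} i j = perm {m} (finToFun i j)

perms-≗⇒≡ : ∀ {m k} {i i′ : Fin ((m !) ^ k)} → (∀ j → perms {m} i j ≗ perms i′ j) → i ≡ i′
perms-≗⇒≡ {m} {k} {i} {i′} eq = begin
  i                                  ≡⟨ funToFin-finToFin {k} {m !} i ⟨
  funToFin (finToFun {m !} {k} i)    ≡⟨ funToFin-cong {k} (λ j → perm-≗⇒≡ {m} (eq j)) ⟩
  funToFin (finToFun {m !} {k} i′)   ≡⟨ funToFin-finToFin {k} {m !} i′ ⟩
  i′                                 ∎
  where open ≡.≡-Reasoning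

codes-bound : ∀ {X N n d k m b} (start : Fin X → Fin N) (steps : Fin X → Fin n → Fin d)
              (labels : Fin X → Fin k → Fin m → Fin b) →
              (∀ {i i′} → start i ≡ start i′ → steps i ≗ steps i′ →
                          (∀ j → labels i j ≗ labels i′ j) → i ≡ i′) →
              X ≤ N * (d ^ n * (b ^ m) ^ k)
codes-bound start steps labels determined = injective⇒≤ code-injective
  where
  code : Fin _ → Fin _
  code i = combine (start i) (combine (funToFin (steps i)) (funToFin (λ j → funToFin (labels i j))))

  code-injective : Injective _≡_ _≡_ code
  code-injective eq with combine-injective _ _ _ _ eq
  ... | start≡ , rest≡ with combine-injective _ _ _ _ rest≡
  ... | steps≡ , labels≡ =
    determined start≡ (funToFin-injective steps≡) (funToFin-injective ∘ funToFin-injective labels≡)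

-- Counting embeddings of paths with matchings

IsWalk : ∀ {N n} → Graph N → (Fin (suc n) → Fin N) → Set
IsWalk U f = ∀ i → adj U (f (inject₁ i)) (f (suc i)) ≡ true

module _ {N d} (U : Graph N) (U≤d : MaxDegreeAtMost U d) where

  walkCode : ∀ {n} (f : Fin (suc n) → Fin N) → IsWalk U f → Fin n → Fin d
  walkCode f walk i = nbrIndex U U≤d (walk i)

  walk-determined : ∀ {n} {f g : Fin (suc n) → Fin N} (f-walk : IsWalk U f) (g-walk : IsWalk U g) →
                    f zero ≡ g zero → walkCode f f-walk ≗ walkCode g g-walk → f ≗ g
  walk-determined f-walk g-walk start≡ codes≡ = <-weakInduction _ start≡ λ i fi≡gi →
    nbrIndex-injective U U U≤d U≤d (f-walk i) (g-walk i) (λ z → cong (λ x → adj U x z) fi≡gi) (codes≡ i)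

  labelledWalks-bound : ∀ {X n k m b} (f : Fin X → Fin (suc n) → Fin N) (walk : ∀ i → IsWalk U (f i))
                        (labels : Fin X → Fin k → Fin m → Fin b) →
                        (∀ {i i′} → f i ≗ f i′ → (∀ j → labels i j ≗ labels i′ j) → i ≡ i′) →
                        X ≤ N * (d ^ n * (b ^ m) ^ k)
  labelledWalks-bound f walk labels determined =
    codes-bound (λ i → f i zero) (λ i → walkCode (f i) (walk i)) labels λ start≡ steps≡ labels≡ →
      determined (walk-determined (walk _) (walk _) start≡ steps≡) labels≡

module _ {N d} (U : Graph N) (U≤d : MaxDegreeAtMost U d) {n m k : ℕ} (m+m≤n : m + m ≤ suc n) where

  open PathWithMatchings {m = m} m+m≤n

  private
    σ : Fin ((m !) ^ k) → Fin k → Fin m → Fin m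
    σ = perms {m} {k}

    H : Fin ((m !) ^ k) → Graph (suc n)
    H i = pathWithMatchings (σ i)

    H-maxDegree : ∀ i → MaxDegreeAtMost (H i) (2 + k)
    H-maxDegree i = pathWithMatchings-maxDegree (σ i) (λ j → perm-injective (finToFun i j))

    H-matching : ∀ i j a → adj (H i) (left a) (right (σ i j a)) ≡ true
    H-matching i = pathWithMatchings-matching (σ i)

  inducedUniversal-bound : InducedUniversal (2 + k) (suc n) U →
                           (m !) ^ k ≤ N * (d ^ n * ((2 + k) ^ m) ^ k)
  inducedUniversal-bound universal = labelledWalks-bound U U≤d f walk labels determined
    where
    f : Fin ((m !) ^ k) → Fin (suc n) → Fin N
    f i = proj₁ (universal (H i) (H-maxDegree i))

    f-induced : ∀ i x y → adj U (f i x) (f i y) ≡ adj (H i) x y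
    f-induced i = proj₂ (proj₂ (universal (H i) (H-maxDegree i)))

    walk : ∀ i → IsWalk U (f i)
    walk i t = trans (f-induced i _ _) (pathWithMatchings-path (σ i) t)

    labels : Fin ((m !) ^ k) → Fin k → Fin m → Fin (2 + k)
    labels i j a = nbrIndex (H i) (H-maxDegree i) (H-matching i j a)

    determined : ∀ {i i′} → f i ≗ f i′ → (∀ j → labels i j ≗ labels i′ j) → i ≡ i′
    determined {i} {i′} f≗ labels≡ = perms-≗⇒≡ λ j a → right-injective
      (nbrIndex-injective (H i) (H i′) (H-maxDegree i) (H-maxDegree i′)
        (H-matching i j a) (H-matching i′ j a) (H≗ (left a)) (labels≡ j a))
      where
      H≗ : ∀ x y → adj (H i) x y ≡ adj (H i′) x y
      H≗ x y = trans (≡.sym (f-induced i x y)) (trans (cong₂ (adj U) (f≗ x) (f≗ y)) (f-induced i′ x y))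

  universal-bound : Universal (2 + k) (suc n) U → (m !) ^ k ≤ N * (d ^ n * (d ^ m) ^ k)
  universal-bound universal = labelledWalks-bound U U≤d f walk labels determined
    where
    f : Fin ((m !) ^ k) → Fin (suc n) → Fin N
    f i = proj₁ (universal (H i) (H-maxDegree i))

    f-injective : ∀ i → Injective _≡_ _≡_ (f i)
    f-injective i = proj₁ (proj₂ (universal (H i) (H-maxDegree i)))

    f-adj : ∀ i {x y} → adj (H i) x y ≡ true → adj U (f i x) (f i y) ≡ true
    f-adj i = proj₂ (proj₂ (universal (H i) (H-maxDegree i))) _ _

    walk : ∀ i → IsWalk U (f i)
    walk i t = f-adj i (pathWithMatchings-path (σ i) t)

    labels : Fin ((m !) ^ k) → Fin k → Fin m → Fin d
    labels i j a = nbrIndex U U≤d (f-adj i (H-matching i j a))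

    determined : ∀ {i i′} → f i ≗ f i′ → (∀ j → labels i j ≗ labels i′ j) → i ≡ i′
    determined {i} {i′} f≗ labels≡ = perms-≗⇒≡ λ j a → right-injective (f-injective i (trans
      (nbrIndex-injective U U U≤d U≤d (f-adj i (H-matching i j a)) (f-adj i′ (H-matching i′ j a))
        (λ z → cong (λ x → adj U x z) (f≗ (left a))) (labels≡ j a))
      (≡.sym (f≗ _))))

-- Factorial estimates

^-distribʳ-* : ∀ a b e → (a * b) ^ e ≡ a ^ e * b ^ e
^-distribʳ-* a b zero    = refl
^-distribʳ-* a b (suc e) = trans (cong (a * b *_) (^-distribʳ-* a b e)) (interchange a b (a ^ e) (b ^ e))
  where
  interchange : ∀ a b x y → a * b * (x * y) ≡ a * x * (b * y)
  interchange = solve-∀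

1+n≤2^n : ∀ n → suc n ≤ 2 ^ n
1+n≤2^n zero    = ≤-refl
1+n≤2^n (suc n) = +-mono-≤ (m^n>0 2 n) (≤-trans (1+n≤2^n n) (≤-reflexive (≡.sym (+-identityʳ _))))

1+h+r≤2*[1+h] : ∀ {h r} → r ≤ suc h → suc (h + r) ≤ 2 * suc h
1+h+r≤2*[1+h] {h} r≤1+h =
  ≤-trans (s≤s (+-monoʳ-≤ h r≤1+h)) (≤-reflexive (cong (λ x → suc (h + suc x)) (≡.sym (+-identityʳ h))))

⌈n/2⌉≤1+⌊n/2⌋ : ∀ n → ⌈ n /2⌉ ≤ suc ⌊ n /2⌋
⌈n/2⌉≤1+⌊n/2⌋ zero          = z≤n
⌈n/2⌉≤1+⌊n/2⌋ (suc zero)    = ≤-refl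
⌈n/2⌉≤1+⌊n/2⌋ (suc (suc n)) = s≤s (⌈n/2⌉≤1+⌊n/2⌋ n)

⌊n/2⌋+⌊n/2⌋≤n : ∀ n → ⌊ n /2⌋ + ⌊ n /2⌋ ≤ n
⌊n/2⌋+⌊n/2⌋≤n n = ≤-trans (+-monoʳ-≤ ⌊ n /2⌋ (⌊n/2⌋≤⌈n/2⌉ n)) (≤-reflexive (⌊n/2⌋+⌈n/2⌉≡n n))

m!*[1+m]^n≤[m+n]! : ∀ m n → m ! * suc m ^ n ≤ (m + n) !
m!*[1+m]^n≤[m+n]! m zero    = ≤-reflexive (trans (*-identityʳ _) (cong _! (≡.sym (+-identityʳ m))))
m!*[1+m]^n≤[m+n]! m (suc n) = begin
  m ! * (suc m * suc m ^ n)   ≡⟨ swap (m !) (suc m) (suc m ^ n) ⟩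
  suc m * (m ! * suc m ^ n)   ≤⟨ *-mono-≤ (s≤s (m≤m+n m n)) (m!*[1+m]^n≤[m+n]! m n) ⟩
  suc (m + n) !               ≡⟨ cong _! (+-suc m n) ⟨
  (m + suc n) !               ∎
  where
  open ≤-Reasoning
  swap : ∀ a b c → a * (b * c) ≡ b * (a * c)
  swap = solve-∀

[1+m]^m≤4^m*m! : ∀ m → suc m ^ m ≤ 4 ^ m * m !
[1+m]^m≤4^m*m! = <-rec _ bound
  where
  2^[h+r]≤4^r : ∀ {h r} → h ≤ r → 2 ^ (h + r) ≤ 4 ^ r
  2^[h+r]≤4^r {h} {r} h≤r = begin
    2 ^ (h + r)     ≤⟨ ^-monoʳ-≤ 2 (+-monoˡ-≤ r h≤r) ⟩
    2 ^ (r + r)     ≡⟨ ^-distribˡ-+-* 2 r r ⟩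
    2 ^ r * 2 ^ r   ≡⟨ ^-distribʳ-* 2 2 r ⟨
    4 ^ r           ∎
    where open ≤-Reasoning

  step : ∀ h r → h ≤ r → r ≤ suc h → suc h ^ h ≤ 4 ^ h * h ! →
         suc (h + r) ^ (h + r) ≤ 4 ^ (h + r) * (h + r) !
  step h r h≤r r≤1+h ih = begin
    suc (h + r) ^ (h + r)                     ≤⟨ ^-monoˡ-≤ (h + r) (1+h+r≤2*[1+h] r≤1+h) ⟩
    (2 * suc h) ^ (h + r)                     ≡⟨ ^-distribʳ-* 2 (suc h) (h + r) ⟩
    2 ^ (h + r) * suc h ^ (h + r)             ≡⟨ cong (2 ^ (h + r) *_) (^-distribˡ-+-* (suc h) h r) ⟩
    2 ^ (h + r) * (suc h ^ h * suc h ^ r)     ≤⟨ *-monoʳ-≤ (2 ^ (h + r)) (*-monoˡ-≤ (suc h ^ r) ih) ⟩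
    2 ^ (h + r) * (4 ^ h * h ! * suc h ^ r)   ≡⟨ regroup (2 ^ (h + r)) (4 ^ h) (h !) (suc h ^ r) ⟩
    2 ^ (h + r) * 4 ^ h * (h ! * suc h ^ r)
      ≤⟨ *-mono-≤ (*-monoˡ-≤ (4 ^ h) (2^[h+r]≤4^r h≤r)) (m!*[1+m]^n≤[m+n]! h r) ⟩
    4 ^ r * 4 ^ h * (h + r) !
      ≡⟨ cong (_* (h + r) !) (trans (*-comm (4 ^ r) (4 ^ h)) (≡.sym (^-distribˡ-+-* 4 h r))) ⟩
    4 ^ (h + r) * (h + r) !                   ∎
    where
    open ≤-Reasoning
    regroup : ∀ a b c d → a * (b * c * d) ≡ a * b * (c * d)
    regroup = solve-∀

  bound : ∀ m → (∀ {h} → h < m → suc h ^ h ≤ 4 ^ h * h !) → suc m ^ m ≤ 4 ^ m * m !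
  bound zero    _  = ≤-refl
  bound (suc m) ih = subst (λ x → suc x ^ x ≤ 4 ^ x * x !) (⌊n/2⌋+⌈n/2⌉≡n (suc m))
    (step _ _ (⌊n/2⌋≤⌈n/2⌉ (suc m)) (⌈n/2⌉≤1+⌊n/2⌋ (suc m)) (ih (⌊n/2⌋<n m)))

n^n≤64^n*⌊n/2⌋!² : ∀ n → n ^ n ≤ 64 ^ n * (⌊ n /2⌋ ! * ⌊ n /2⌋ !)
n^n≤64^n*⌊n/2⌋!² n = subst (λ x → x ^ x ≤ 64 ^ x * (⌊ n /2⌋ ! * ⌊ n /2⌋ !)) (⌊n/2⌋+⌈n/2⌉≡n n)
  (halves ⌊ n /2⌋ ⌈ n /2⌉ (⌊n/2⌋≤⌈n/2⌉ n) (⌈n/2⌉≤1+⌊n/2⌋ n))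
  where
  halves : ∀ h r → h ≤ r → r ≤ suc h → (h + r) ^ (h + r) ≤ 64 ^ (h + r) * (h ! * h !)
  halves h r h≤r r≤1+h = begin
    s ^ s
      ≤⟨ ^-monoˡ-≤ s (≤-trans (n≤1+n s) (1+h+r≤2*[1+h] r≤1+h)) ⟩
    (2 * suc h) ^ s                                   ≡⟨ ^-distribʳ-* 2 (suc h) s ⟩
    2 ^ s * suc h ^ s
      ≤⟨ *-monoʳ-≤ (2 ^ s) (^-monoʳ-≤ (suc h) (+-monoʳ-≤ h r≤1+h)) ⟩
    2 ^ s * suc h ^ (h + suc h)
      ≡⟨ cong (2 ^ s *_) (^-distribˡ-+-* (suc h) h (suc h)) ⟩
    2 ^ s * (suc h ^ h * (suc h * suc h ^ h))
      ≤⟨ *-monoʳ-≤ (2 ^ s) (*-mono-≤ [1+h]^h (*-mono-≤ (1+n≤2^n h) [1+h]^h)) ⟩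
    2 ^ s * (4 ^ h * h ! * (2 ^ h * (4 ^ h * h !)))   ≡⟨ regroup (2 ^ s) (2 ^ h) (4 ^ h) (h !) ⟩
    2 ^ s * 2 ^ h * 4 ^ h * 4 ^ h * (h ! * h !)
      ≤⟨ *-monoˡ-≤ (h ! * h !) (*-mono-≤ (*-mono-≤ (*-monoʳ-≤ (2 ^ s) (^-monoʳ-≤ 2 h≤s))
                                                   (^-monoʳ-≤ 4 h≤s))
                                         (^-monoʳ-≤ 4 h≤s)) ⟩
    2 ^ s * 2 ^ s * 4 ^ s * 4 ^ s * (h ! * h !)       ≡⟨ cong (_* (h ! * h !)) 2^s*2^s*4^s*4^s≡64^s ⟩
    64 ^ s * (h ! * h !)                              ∎
    where
    open ≤-Reasoning
    s = h + r
    h≤s : h ≤ s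
    h≤s = m≤m+n h r
    [1+h]^h : suc h ^ h ≤ 4 ^ h * h !
    [1+h]^h = [1+m]^m≤4^m*m! h
    regroup : ∀ a b c f → a * (c * f * (b * (c * f))) ≡ a * b * c * c * (f * f)
    regroup = solve-∀
    2^s*2^s*4^s*4^s≡64^s : 2 ^ s * 2 ^ s * 4 ^ s * 4 ^ s ≡ 64 ^ s
    2^s*2^s*4^s*4^s≡64^s = ≡.sym (begin-equality
      (2 * 2 * 4 * 4) ^ s             ≡⟨ ^-distribʳ-* (2 * 2 * 4) 4 s ⟩
      (2 * 2 * 4) ^ s * 4 ^ s         ≡⟨ cong (_* 4 ^ s) (^-distribʳ-* (2 * 2) 4 s) ⟩
      (2 * 2) ^ s * 4 ^ s * 4 ^ s     ≡⟨ cong (λ x → x * 4 ^ s * 4 ^ s) (^-distribʳ-* 2 2 s) ⟩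
      2 ^ s * 2 ^ s * 4 ^ s * 4 ^ s   ∎)

squared-count-bound : ∀ {n n′ m k N d b C X} .{{_ : NonZero d}} .{{_ : NonZero b}} →
                      n′ ≤ n → m + m ≤ n → n ^ n ≤ C ^ n * (X * X) → X ^ k ≤ N * (d ^ n′ * (b ^ m) ^ k) →
                      n ^ (n * k) ≤ N ^ 2 * d ^ (2 * n) * (C ^ (n * k) * b ^ (n * k))
squared-count-bound {n} {n′} {m} {k} {N} {d} {b} {C} {X} n′≤n m+m≤n nⁿ≤ Xᵏ≤ = begin
  n ^ (n * k)                                        ≡⟨ ^-*-assoc n n k ⟨
  (n ^ n) ^ k                                        ≤⟨ ^-monoˡ-≤ k nⁿ≤ ⟩
  (C ^ n * (X * X)) ^ k                              ≡⟨ ^-distribʳ-* (C ^ n) (X * X) k ⟩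
  (C ^ n) ^ k * (X * X) ^ k                          ≡⟨ cong₂ _*_ (^-*-assoc C n k) (^-distribʳ-* X X k) ⟩
  C ^ (n * k) * (X ^ k * X ^ k)                      ≤⟨ *-monoʳ-≤ (C ^ (n * k)) (*-mono-≤ Xᵏ≤ Xᵏ≤) ⟩
  C ^ (n * k) * (N * (D * E) * (N * (D * E)))        ≡⟨ regroup (C ^ (n * k)) N D E ⟩
  N ^ 2 * (D * D) * (C ^ (n * k) * (E * E))
    ≤⟨ *-mono-≤ (*-monoʳ-≤ (N ^ 2) D²≤) (*-monoʳ-≤ (C ^ (n * k)) E²≤) ⟩
  N ^ 2 * d ^ (2 * n) * (C ^ (n * k) * b ^ (n * k))  ∎
  where
  open ≤-Reasoning
  D = d ^ n′
  E = (b ^ m) ^ k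
  -- x * (x * 1) is x ^ 2 unfolded; solve-∀ fails on the literal power.
  regroup : ∀ c x y z → c * (x * (y * z) * (x * (y * z))) ≡ x * (x * 1) * (y * y) * (c * (z * z))
  regroup = solve-∀
  D²≤ : D * D ≤ d ^ (2 * n)
  D²≤ = begin
    d ^ n′ * d ^ n′   ≡⟨ ^-distribˡ-+-* d n′ n′ ⟨
    d ^ (n′ + n′)     ≤⟨ ^-monoʳ-≤ d (+-mono-≤ n′≤n (≤-trans n′≤n (≤-reflexive (≡.sym (+-identityʳ n))))) ⟩
    d ^ (2 * n)       ∎
  E²≤ : E * E ≤ b ^ (n * k)
  E²≤ = begin
    (b ^ m) ^ k * (b ^ m) ^ k   ≡⟨ cong₂ _*_ (^-*-assoc b m k) (^-*-assoc b m k) ⟩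
    b ^ (m * k) * b ^ (m * k)   ≡⟨ ^-distribˡ-+-* b (m * k) (m * k) ⟨
    b ^ (m * k + m * k)         ≡⟨ cong (b ^_) (*-distribʳ-+ k m m) ⟨
    b ^ ((m + m) * k)           ≤⟨ ^-monoʳ-≤ b (*-monoˡ-≤ k m+m≤n) ⟩
    b ^ (n * k)                 ∎

K : ℕ → ℕ
K Δ = (64 * Δ) ^ (2 * Δ)

K^[2n] : ∀ Δ n → K Δ ^ (2 * n) ≡ 64 ^ (4 * Δ * n) * Δ ^ (4 * Δ * n)
K^[2n] Δ n = begin
  ((64 * Δ) ^ (2 * Δ)) ^ (2 * n)       ≡⟨ ^-*-assoc (64 * Δ) (2 * Δ) (2 * n) ⟩
  (64 * Δ) ^ (2 * Δ * (2 * n))         ≡⟨ cong ((64 * Δ) ^_) (exponent Δ n) ⟩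
  (64 * Δ) ^ (4 * Δ * n)               ≡⟨ ^-distribʳ-* 64 Δ (4 * Δ * n) ⟩
  64 ^ (4 * Δ * n) * Δ ^ (4 * Δ * n)   ∎
  where
  open ≡.≡-Reasoning
  exponent : ∀ Δ n → 2 * Δ * (2 * n) ≡ 4 * Δ * n
  exponent = solve-∀

count⇒size : ∀ {n k N d b} .{{_ : NonZero d}} .{{_ : NonZero b}} →
             (⌊ suc n /2⌋ !) ^ k ≤ N * (d ^ n * (b ^ ⌊ suc n /2⌋) ^ k) →
             suc n ^ (suc n * k)
               ≤ N ^ 2 * (4 * d) ^ (2 * suc n) * (64 ^ (4 * (2 + k) * suc n) * b ^ (4 * (2 + k) * suc n))
count⇒size {n} {k} {N} {d} {b} count≤ = begin
  suc n ^ (suc n * k)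
    ≤⟨ squared-count-bound {m = ⌊ suc n /2⌋} {k} {N} {d} {b} {64} {⌊ suc n /2⌋ !}
         (n≤1+n n) (⌊n/2⌋+⌊n/2⌋≤n (suc n)) (n^n≤64^n*⌊n/2⌋!² (suc n)) count≤ ⟩
  N ^ 2 * d ^ (2 * suc n) * (64 ^ (suc n * k) * b ^ (suc n * k))
    ≤⟨ *-mono-≤ (*-monoʳ-≤ (N ^ 2) (^-monoˡ-≤ (2 * suc n) (m≤n*m d 4)))
                (*-mono-≤ (^-monoʳ-≤ 64 nk≤E) (^-monoʳ-≤ b nk≤E)) ⟩
  N ^ 2 * (4 * d) ^ (2 * suc n) * (64 ^ E * b ^ E)    ∎
  where
  open ≤-Reasoning
  E = 4 * (2 + k) * suc n
  nk≤E : suc n * k ≤ E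
  nk≤E = ≤-trans (m≤m+n (suc n * k) (8 * suc n + 3 * (suc n * k))) (≤-reflexive (expand k (suc n)))
    where
    expand : ∀ k n → n * k + (8 * n + 3 * (n * k)) ≡ 4 * (2 + k) * n
    expand = solve-∀

n^[[2+k]n]≡n^[2n]*n^[nk] : ∀ n k → n ^ ((2 + k) * n) ≡ n ^ (2 * n) * n ^ (n * k)
n^[[2+k]n]≡n^[2n]*n^[nk] n k = trans (cong (n ^_) (exponent n k)) (^-distribˡ-+-* n (2 * n) (n * k))
  where
  exponent : ∀ n k → (2 + k) * n ≡ 2 * n + n * k
  exponent = solve-∀

maxDegree1-size : ∀ {n N d} .{{_ : NonZero n}} .{{_ : NonZero N}} .{{_ : NonZero d}} →
                  n ^ (1 * n) ≤ N ^ 2 * (4 * d) ^ (2 * n) * n ^ (2 * n) * K 1 ^ (2 * n)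
maxDegree1-size {n} {N} {d} = begin
  n ^ (1 * n)                                               ≤⟨ ^-monoʳ-≤ n (*-monoˡ-≤ n {1} {2} (s≤s z≤n)) ⟩
  n ^ (2 * n)                                               ≡⟨ pad (n ^ (2 * n)) ⟩
  1 * 1 * n ^ (2 * n) * 1
    ≤⟨ *-mono-≤ (*-mono-≤ (*-mono-≤ (m^n>0 N 2) (m^n>0 (4 * d) {{m*n≢0 4 d}} (2 * n))) ≤-refl)
                (m^n>0 (K 1) (2 * n)) ⟩
  N ^ 2 * (4 * d) ^ (2 * n) * n ^ (2 * n) * K 1 ^ (2 * n)   ∎
  where
  open ≤-Reasoning
  pad : ∀ x → x ≡ 1 * 1 * x * 1
  pad = solve-∀

inducedUniversal-size : ∀ {Δ n d N} {U : Graph N} → Δ ≥ 1 → n ≥ 1 → d ≥ 1 →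
                        HasMaxDegree U d → InducedUniversal Δ n U →
                        n ^ (Δ * n) ≤ N ^ 2 * (4 * d) ^ (2 * n) * n ^ (2 * n) * K Δ ^ (2 * n)
inducedUniversal-size {1} {suc n′} {suc d′} {N} (s≤s z≤n) (s≤s z≤n) (s≤s z≤n) (_ , v , _) _ =
  maxDegree1-size {suc n′} {N} {suc d′} {{_}} {{nonZeroIndex v}}
inducedUniversal-size {suc (suc k)} {suc n′} {suc d′} {N} {U} (s≤s z≤n) (s≤s z≤n) (s≤s z≤n)
                      (U≤d , _) universal = begin
  n ^ (Δ * n)                            ≡⟨ n^[[2+k]n]≡n^[2n]*n^[nk] n k ⟩
  n ^ (2 * n) * n ^ (n * k)              ≤⟨ *-monoʳ-≤ (n ^ (2 * n)) (count⇒size {n′} {k} {N} {d} counted) ⟩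
  n ^ (2 * n) * (A * (64 ^ E * Δ ^ E))   ≡⟨ regroup (n ^ (2 * n)) A (64 ^ E * Δ ^ E) ⟩
  A * n ^ (2 * n) * (64 ^ E * Δ ^ E)     ≡⟨ cong (A * n ^ (2 * n) *_) (K^[2n] Δ n) ⟨
  A * n ^ (2 * n) * K Δ ^ (2 * n)        ∎
  where
  open ≤-Reasoning
  n = suc n′
  d = suc d′
  Δ = 2 + k
  E = 4 * Δ * n
  A = N ^ 2 * (4 * d) ^ (2 * n)
  counted = inducedUniversal-bound U U≤d {m = ⌊ n /2⌋} (⌊n/2⌋+⌊n/2⌋≤n n) universal
  regroup : ∀ a b c → a * (b * c) ≡ b * a * c
  regroup = solve-∀

universal-size : ∀ {Δ n d N} {U : Graph N} → Δ ≥ 1 → n ≥ 1 → d ≥ 1 →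
                 HasMaxDegree U d → Universal Δ n U →
                 n ^ (Δ * n) * Δ ^ (4 * Δ * n)
                   ≤ N ^ 2 * (4 * d) ^ (2 * n) * n ^ (2 * n) * K Δ ^ (2 * n) * d ^ (4 * Δ * n)
universal-size {1} {suc n′} {suc d′} {N} (s≤s z≤n) (s≤s z≤n) (s≤s z≤n) (_ , v , _) _ =
  *-mono-≤ (maxDegree1-size {suc n′} {N} {suc d′} {{_}} {{nonZeroIndex v}})
           (≤-trans (≤-reflexive (^-zeroˡ (4 * 1 * suc n′))) (m^n>0 (suc d′) (4 * 1 * suc n′)))
universal-size {suc (suc k)} {suc n′} {suc d′} {N} {U} (s≤s z≤n) (s≤s z≤n) (s≤s z≤n)
               (U≤d , _) universal = begin
  n ^ (Δ * n) * Δ ^ E                            ≡⟨ cong (_* Δ ^ E) (n^[[2+k]n]≡n^[2n]*n^[nk] n k) ⟩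
  n ^ (2 * n) * n ^ (n * k) * Δ ^ E
    ≤⟨ *-monoˡ-≤ (Δ ^ E) (*-monoʳ-≤ (n ^ (2 * n)) (count⇒size {n′} {k} {N} {d} counted)) ⟩
  n ^ (2 * n) * (A * (64 ^ E * d ^ E)) * Δ ^ E   ≡⟨ regroup (n ^ (2 * n)) A (64 ^ E) (d ^ E) (Δ ^ E) ⟩
  A * n ^ (2 * n) * (64 ^ E * Δ ^ E) * d ^ E     ≡⟨ cong (λ x → A * n ^ (2 * n) * x * d ^ E) (K^[2n] Δ n) ⟨
  A * n ^ (2 * n) * K Δ ^ (2 * n) * d ^ E        ∎
  where
  open ≤-Reasoning
  n = suc n′
  d = suc d′
  Δ = 2 + k
  E = 4 * Δ * n
  A = N ^ 2 * (4 * d) ^ (2 * n)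
  counted = universal-bound U U≤d {m = ⌊ n /2⌋} (⌊n/2⌋+⌊n/2⌋≤n n) universal
  regroup : ∀ a b x y z → a * (b * (x * y)) * z ≡ b * a * (x * z) * y
  regroup = solve-∀

theorem4p1 : (Δ : ℕ) → Δ ≥ 1 →
    Σ ℕ λ K → K ≥ 1 ×
      ((n d : ℕ) → n ≥ 2 → d ≥ 1 →
        ((N : ℕ) (U : Graph N) → HasMaxDegree U d → InducedUniversal Δ n U →
          n ^ (Δ * n) ≤ N ^ 2 * (4 * d) ^ (2 * n) * n ^ (2 * n) * K ^ (2 * n))
        ×
        ((N′ : ℕ) (U′ : Graph N′) → HasMaxDegree U′ d → Universal Δ n U′ →
          n ^ (Δ * n) * Δ ^ (4 * Δ * n)
            ≤ N′ ^ 2 * (4 * d) ^ (2 * n) * n ^ (2 * n) * K ^ (2 * n) * d ^ (4 * Δ * n)))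
theorem4p1 Δ Δ≥1@(s≤s z≤n) = K Δ , m^n>0 (64 * Δ) (2 * Δ) , λ n d n≥2 d≥1 →
  (λ _ U → inducedUniversal-size {U = U} Δ≥1 (≤-trans (n≤1+n 1) n≥2) d≥1) ,
  (λ _ U → universal-size {U = U} Δ≥1 (≤-trans (n≤1+n 1) n≥2) d≥1)
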